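{- For $n\geq 2$, we have $CUD^{(B)}_{n,n}=t^2CUD^{(D)}_{n,n}$.
   Context: A permutation is written in standard cycle notation: each cycle begins with its smallest entry and the first entries of the cycles increase; it is cycle-up-down if every cycle $(c_1,c_2,\dots,c_r)$ satisfies $c_1<c_2>c_3<\cdots$. A signed permutation of $[n]$ ($\bar i=-i$) decomposes into cycles coming either in pairs $(a_1,\dots,a_r)(\bar a_1,\dots,\bar a_r)$, written $(a_1,\dots,a_r)$, or as single cycles $(a_1,\dots,a_r,\bar a_1,\dots,\bar a_r)$; it is special if it has none of the second kind; $|\sigma|$ takes absolute values of all entries in the cycle notation. $\mathcal{CUD}^{(B)}_n$: special signed permutations $(a_{1,1},a_{1,2},\ldots)\cdots(a_{m,1},\ldots)$ with all $a_{i,1}>0$ and $|\sigma|$ cycle-up-down. $\mathcal{CUD}^{(D)}_n$: signed permutations of the form $(a_{1,1},\ldots)\cdots(a_{m-1,1},\ldots)(a_{m,1},\overline{a_{m,1}})$, no other cycle of the form $(a,\bar a)$, all $a_{i,1}>0$, and $|\sigma|$ cycle-up-down (reading the last cycle as $(a_{m,1})$). $\mathcal{CUD}^{(B)}_{n,k}$, $\mathcal{CUD}^{(D)}_{n,k}$ are the subsets with $a_{m,1}=k$. $\mathsf{npk}(\sigma)=\#\{a_{i,j}<0 : |a_{i,j}|\ge|a_{i,j-1}|\}$, with the element $i$ of the last cycle $(i,\bar i)$ of a type $D$ permutation also contributing $1$. Define $CUD^{(B)}_{n,k}(t)=\sum_{\sigma\in\mathcal{CUD}^{(B)}_{n,k}}t^{n+1-2\,\mathsf{npk}(\sigma)}$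 and $CUD^{(D)}_{n,k}(t)=\sum_{\sigma\in\mathcal{CUD}^{(D)}_{n,k}}t^{n+1-2\,\mathsf{npk}(\sigma)}$. -}

module Defs where

open import Data.Bool using (Bool; true; false; _∧_; _∨_; not; T)
open import Data.Nat as ℕ using (ℕ; zero; suc; _≤ᵇ_; _<ᵇ_; _≡ᵇ_)
open import Data.Integer as ℤ using (ℤ; +_; ∣_∣)
open import Data.List.Base using (List; []; _∷_; map; concat; _∷ʳ_; upTo)
open import Relation.Binary.PropositionalEquality using (_≡_)
open import Data.Maybe using (Maybe; just; nothing)
open import Data.Product using (_×_; _,_)
open import Relation.Nullary.Decidable using (⌊_⌋)

-- A signed permutation is represented literally by its cycle notation:
-- a list of cycles, each cycle a list of nonzero integers (ī = -i).
-- For the classes considered here every cycle except (in type D) the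
-- last cycle (k , k̄) stands for a pair (a₁,…,a_r)(ā₁,…,ā_r), written
-- by its representative with positive first entry.

every : {A : Set} → (A → Bool) → List A → Bool
every p []       = true
every p (x ∷ xs) = p x ∧ every p xs

SignedCycles : Set
SignedCycles = List (List ℤ)

absCycles : SignedCycles → List (List ℕ)
absCycles = map (map ∣_∣)

count : ℕ → List ℕ → ℕ
count i []       = zero
count i (x ∷ xs) with i ≡ᵇ x
... | true  = suc (count i xs)
... | false = count i xs

oneTo : ℕ → List ℕ
oneTo n = map suc (upTo n)

isListingOf : ℕ → List ℕ → Bool
isListingOf n xs =
  every (λ x → (1 ≤ᵇ x) ∧ (x ≤ᵇ n)) xs ∧ every (λ i → count i xs ≡ᵇ 1) (oneTo n)

startsWithMin : List ℕ → Bool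
startsWithMin []       = false
startsWithMin (c ∷ cs) = every (λ x → c <ᵇ x) cs

headsIncreasing : List (List ℕ) → Bool
headsIncreasing []                         = true
headsIncreasing (_ ∷ [])                   = true
headsIncreasing ([] ∷ _ ∷ _)               = false
headsIncreasing ((a ∷ _) ∷ [] ∷ _)         = false
headsIncreasing ((a ∷ as) ∷ (b ∷ bs) ∷ cs) =
  (a <ᵇ b) ∧ headsIncreasing ((b ∷ bs) ∷ cs)

isStandard : List (List ℕ) → Bool
isStandard cs = every startsWithMin cs ∧ headsIncreasing cs

mutual
  upDownAsc : List ℕ → Bool
  upDownAsc []           = true
  upDownAsc (_ ∷ [])     = true
  upDownAsc (a ∷ b ∷ cs) = (a <ᵇ b) ∧ upDownDesc (b ∷ cs)

  upDownDesc : List ℕ → Bool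
  upDownDesc []           = true
  upDownDesc (_ ∷ [])     = true
  upDownDesc (a ∷ b ∷ cs) = (b <ᵇ a) ∧ upDownAsc (b ∷ cs)

isCycleUpDown : ℕ → List (List ℕ) → Bool
isCycleUpDown n cs =
  isListingOf n (concat cs) ∧ isStandard cs ∧ every upDownAsc cs

firstPositive : List ℤ → Bool
firstPositive []      = false
firstPositive (a ∷ _) = ⌊ + 1 ℤ.≤? a ⌋

allFirstPositive : SignedCycles → Bool
allFirstPositive = every firstPositive

lastHead : SignedCycles → Maybe ℤ
lastHead []               = nothing
lastHead ([] ∷ [])        = nothing
lastHead ((a ∷ _) ∷ [])   = just a
lastHead (_ ∷ c ∷ cs)     = lastHead (c ∷ cs)

isHead : ℕ → SignedCycles → Bool
isHead k σ with lastHead σ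
... | just a  = ⌊ a ℤ.≟ + k ⌋
... | nothing = false

splitLast : {A : Set} → List A → Maybe (List A × A)
splitLast []       = nothing
splitLast (x ∷ xs) with splitLast xs
... | nothing        = just ([] , x)
... | just (ys , y)  = just (x ∷ ys , y)

inCUDB : ℕ → ℕ → SignedCycles → Bool
inCUDB n k σ =
  allFirstPositive σ ∧ isCycleUpDown n (absCycles σ) ∧ isHead k σ

isNegPair : ℕ → List ℤ → Bool
isNegPair k (a ∷ b ∷ []) = ⌊ a ℤ.≟ + k ⌋ ∧ ⌊ b ℤ.≟ ℤ.- (+ k) ⌋
isNegPair k _            = false

-- σ ∈ CUD^(D)_{n,k}: σ = (a_{1,1},…)⋯(a_{m-1,1},…)(k , k̄), every
-- a_{i,1} > 0, and |σ| with the last cycle read as (k) cycle-up-down.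
-- (No other cycle can be of the form (a , ā), since the absolute values
-- of the entries form a listing of [n].)
inCUDD : ℕ → ℕ → SignedCycles → Bool
inCUDD n k σ with splitLast σ
... | nothing       = false
... | just (τ , c)  =
  isNegPair k c ∧ inCUDB n k (τ ∷ʳ (+ k ∷ []))

-- npk(σ) = #{ a_{i,j} < 0 : |a_{i,j}| ≥ |a_{i,j-1}| }  (j ≥ 2).
-- Applied to the literal cycle list of a type D permutation, the last
-- cycle (k , k̄) contributes exactly 1 (entry k̄ < 0 with |k̄| ≥ |k|).

npkFrom : ℤ → List ℤ → ℕ
npkFrom p []       = zero
npkFrom p (c ∷ cs) with ⌊ c ℤ.<? + 0 ⌋ ∧ (∣ p ∣ ≤ᵇ ∣ c ∣)
... | true  = suc (npkFrom c cs)
... | false = npkFrom c cs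

npkCycle : List ℤ → ℕ
npkCycle []       = zero
npkCycle (c ∷ cs) = npkFrom c cs

npk : SignedCycles → ℕ
npk []       = zero
npk (c ∷ cs) = npkCycle c ℕ.+ npk cs

weight : ℕ → SignedCycles → ℤ
weight n σ = + (suc n) ℤ.- + (2 ℕ.* npk σ)

-- Coefficient fibres of the generating functions
--   CUD^(B)_{n,k}(t) = Σ_{σ ∈ CUD^(B)_{n,k}} t^{n+1-2 npk σ}
--   CUD^(D)_{n,k}(t) = Σ_{σ ∈ CUD^(D)_{n,k}} t^{n+1-2 npk σ}
-- The coefficient of t^e is the cardinality of the fibre below.

FibreB : ℕ → ℕ → ℤ → Set
FibreB n k e = Data.Product.Σ SignedCycles (λ σ → T (inCUDB n k σ) × weight n σ ≡ e)

FibreD : ℕ → ℕ → ℤ → Set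
FibreD n k e = Data.Product.Σ SignedCycles (λ σ → T (inCUDD n k σ) × weight n σ ≡ e)

-- In σ ∈ CUD^(B)_{n,n} the last cycle is headed by the largest letter n, and cycles start
-- with their minimum, so that cycle is (n). Replacing it by (n, n̄) is a bijection onto
-- CUD^(D)_{n,n} which keeps the other cycles and raises npk by exactly one (the letter n̄ is
-- negative with |n̄| ≥ n), hence lowers the exponent n + 1 − 2 npk by 2.
module Submission where

open import Defs
open import Data.Nat using (ℕ; _≤_)
open import Data.Integer using (ℤ; +_; _-_)
open import Function.Bundles using (_↔_)

open import Axiom.UniquenessOfIdentityProofs using (UIP; module Decidable⇒UIP)
open import Algebra.Bundles using (AbelianGroup)
open import Data.Bool using (Bool; true; _∧_; T)
open import Data.Bool.Properties using (T-∧; T-≡; T-irrelevant)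
open import Data.Nat as ℕ using (suc; _≤ᵇ_)
import Data.Nat.Properties as ℕ
import Data.Integer as ℤ
import Data.Integer.Properties as ℤ
open import Data.Integer.Tactic.RingSolver using (solve-∀)
open import Data.List.Base using (List; []; _∷_; _++_; _∷ʳ_; concat; map)
open import Data.List.Properties using (∷ʳ-injectiveˡ)
open import Data.Maybe using (just; nothing)
open import Data.Product as Product using (Σ; _×_; _,_; proj₁; proj₂)
open import Function.Base using (_∘_)
open import Function.Bundles using (Equivalence; mk↔ₛ′)
open import Function.Definitions using (Injective)
open import Function.Related.Propositional using (module EquationalReasoning)
open import Relation.Binary.PropositionalEquality
open import Relation.Nullary.Decidable using (⌊_⌋; fromWitness; toWitness)
open import Relation.Nullary.Negation using (contradiction)

open import Algebra.Properties.Group (AbelianGroup.group ℤ.+-0-abelianGroup)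
  using (∙-cancelʳ)

T-∧⁻ˡ : ∀ {x y} → T (x ∧ y) → T x
T-∧⁻ˡ = proj₁ ∘ Equivalence.to T-∧

T-∧⁻ʳ : ∀ {x y} → T (x ∧ y) → T y
T-∧⁻ʳ = proj₂ ∘ Equivalence.to T-∧

every-mono : {A : Set} {p q : A → Bool} → (∀ {x} → T (p x) → T (q x)) →
  ∀ xs → T (every p xs) → T (every q xs)
every-mono p⇒q []       _  = _
every-mono p⇒q (x ∷ xs) px = Equivalence.from T-∧ (p⇒q (T-∧⁻ˡ px) , every-mono p⇒q xs (T-∧⁻ʳ px))

every-++⁻ʳ : {A : Set} (p : A → Bool) (xs : List A) {ys : List A} →
  T (every p (xs ++ ys)) → T (every p ys)
every-++⁻ʳ p []       pys = pys
every-++⁻ʳ p (x ∷ xs) pxs = every-++⁻ʳ p xs (T-∧⁻ʳ pxs)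

Fibre : {A : Set} → (A → Bool) → (A → ℤ) → ℤ → Set
Fibre {A} P w e = Σ A λ a → T (P a) × w a ≡ e

ℤ-UIP : UIP ℤ
ℤ-UIP = Decidable⇒UIP.≡-irrelevant ℤ._≟_

Fibre-≡ : {A : Set} {P : A → Bool} {w : A → ℤ} {e : ℤ} {x y : Fibre P w e} →
  proj₁ x ≡ proj₁ y → x ≡ y
Fibre-≡ {x = a , p , q} {y = .a , p′ , q′} refl =
  cong₂ (λ p q → a , p , q) (T-irrelevant p p′) (ℤ-UIP q q′)

Fibre-↔-image : {A B : Set} {P : A → Bool} {w : A → ℤ} {e : ℤ} (f : B → A) →
  Injective _≡_ _≡_ f → (∀ a → T (P a) → Σ B λ b → f b ≡ a) →
  Fibre P w e ↔ Fibre (P ∘ f) (w ∘ f) e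
Fibre-↔-image {P = P} {w} f f-inj onto = mk↔ₛ′ to from to∘from from∘to
  where
  to : Fibre P w _ → Fibre (P ∘ f) (w ∘ f) _
  to (a , p , q) with b , fb≡a ← onto a p =
    b , subst (T ∘ P) (sym fb≡a) p , trans (cong w fb≡a) q
  from : Fibre (P ∘ f) (w ∘ f) _ → Fibre P w _
  from (b , p , q) = f b , p , q
  to∘from : ∀ y → to (from y) ≡ y
  to∘from (b , p , q) = Fibre-≡ (f-inj (proj₂ (onto (f b) p)))
  from∘to : ∀ x → from (to x) ≡ x
  from∘to (a , p , q) = Fibre-≡ (proj₂ (onto a p))

Fibre-↔-shift : {A : Set} {P Q : A → Bool} {w v : A → ℤ} {e d : ℤ} →
  (∀ a → P a ≡ Q a) → (∀ a → v a ≡ w a ℤ.+ d) → Fibre P w e ↔ Fibre Q v (e ℤ.+ d)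
Fibre-↔-shift {P = P} {Q} {w} {v} {e} {d} P≡Q v≡w+d =
  mk↔ₛ′ to from (λ _ → Fibre-≡ refl) (λ _ → Fibre-≡ refl)
  where
  to : Fibre P w e → Fibre Q v (e ℤ.+ d)
  to (a , p , q) = a , subst T (P≡Q a) p , trans (v≡w+d a) (cong (ℤ._+ d) q)
  from : Fibre Q v (e ℤ.+ d) → Fibre P w e
  from (a , p , q) = a , subst T (sym (P≡Q a)) p , ∙-cancelʳ d (w a) e (trans (sym (v≡w+d a)) q)

lastHead-max-singleton : ∀ n σ →
  T (every (λ x → x ≤ᵇ n) (concat (absCycles σ))) →
  T (every startsWithMin (absCycles σ)) →
  lastHead σ ≡ just (+ n) → Σ SignedCycles λ τ → τ ∷ʳ (+ n ∷ []) ≡ σ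
lastHead-max-singleton n ((a ∷ []) ∷ []) _ _ refl = [] , refl
lastHead-max-singleton n ((a ∷ x ∷ xs) ∷ []) bounded min refl =
  contradiction (ℕ.≤ᵇ⇒≤ ℤ.∣ x ∣ n (T-∧⁻ˡ (T-∧⁻ʳ {n ≤ᵇ n} bounded)))
    (ℕ.<⇒≱ (ℕ.<ᵇ⇒< n ℤ.∣ x ∣ (T-∧⁻ˡ (T-∧⁻ˡ min))))
lastHead-max-singleton n ((a ∷ as) ∷ c ∷ cs) bounded min last =
  Product.map ((a ∷ as) ∷_) (cong ((a ∷ as) ∷_))
    (lastHead-max-singleton n (c ∷ cs) (every-++⁻ʳ (_≤ᵇ n) (map ℤ.∣_∣ (a ∷ as)) bounded)
      (T-∧⁻ʳ {startsWithMin (map ℤ.∣_∣ (a ∷ as))} min) last)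

isHead⇒lastHead : ∀ k σ → T (isHead k σ) → lastHead σ ≡ just (+ k)
isHead⇒lastHead k σ hd with lastHead σ
... | just a = cong just (toWitness hd)

inCUDB-max-last : ∀ n σ → T (inCUDB n n σ) → Σ SignedCycles λ τ → τ ∷ʳ (+ n ∷ []) ≡ σ
inCUDB-max-last n σ p = lastHead-max-singleton n σ
  (every-mono T-∧⁻ʳ |σ| (T-∧⁻ˡ listing)) (T-∧⁻ˡ standard) (isHead⇒lastHead n σ head)
  where
  |σ| : List ℕ
  |σ| = concat (absCycles σ)
  upDown : T (isCycleUpDown n (absCycles σ))
  upDown = T-∧⁻ˡ (T-∧⁻ʳ {allFirstPositive σ} p)
  head : T (isHead n σ)
  head = T-∧⁻ʳ (T-∧⁻ʳ {allFirstPositive σ} p)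
  listing : T (isListingOf n |σ|)
  listing = T-∧⁻ˡ upDown
  standard : T (isStandard (absCycles σ))
  standard = T-∧⁻ˡ (T-∧⁻ʳ {isListingOf n |σ|} upDown)

splitLast-∷ʳ : {A : Set} (xs : List A) (x : A) → splitLast (xs ∷ʳ x) ≡ just (xs , x)
splitLast-∷ʳ []       x = refl
splitLast-∷ʳ (y ∷ xs) x rewrite splitLast-∷ʳ xs x = refl

splitLast-nothing : {A : Set} (xs : List A) → splitLast xs ≡ nothing → xs ≡ []
splitLast-nothing []       _  = refl
splitLast-nothing (x ∷ xs) eq with splitLast xs
splitLast-nothing (x ∷ xs) () | nothing
splitLast-nothing (x ∷ xs) () | just _

splitLast-just : {A : Set} (xs : List A) {ys : List A} {y : A} →
  splitLast xs ≡ just (ys , y) → ys ∷ʳ y ≡ xs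
splitLast-just (x ∷ xs) eq with splitLast xs in split
splitLast-just (x ∷ xs) refl | nothing       = cong (x ∷_) (sym (splitLast-nothing xs split))
splitLast-just (x ∷ xs) refl | just (ys , y) = cong (x ∷_) (splitLast-just xs split)

pair : ℕ → List ℤ
pair k = + k ∷ ℤ.- (+ k) ∷ []

isNegPair⇒≡pair : ∀ k c → T (isNegPair k c) → c ≡ pair k
isNegPair⇒≡pair k (a ∷ b ∷ []) p
  with refl ← toWitness {a? = a ℤ.≟ + k} (T-∧⁻ˡ p)
     | refl ← toWitness {a? = b ℤ.≟ ℤ.- (+ k)} (T-∧⁻ʳ {⌊ a ℤ.≟ + k ⌋} p) = refl

isNegPair-pair : ∀ k → isNegPair k (pair k) ≡ true
isNegPair-pair k = Equivalence.to T-≡ (Equivalence.from T-∧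
  (fromWitness {a? = + k ℤ.≟ + k} refl , fromWitness {a? = ℤ.- (+ k) ℤ.≟ ℤ.- (+ k)} refl))

inCUDD-pair-last : ∀ n k σ → T (inCUDD n k σ) → Σ SignedCycles λ τ → τ ∷ʳ pair k ≡ σ
inCUDD-pair-last n k σ p with splitLast σ in split
... | just (τ , c) with refl ← isNegPair⇒≡pair k c (T-∧⁻ˡ p) = τ , splitLast-just σ split

inCUDD-∷ʳ-pair : ∀ n k τ → inCUDD n k (τ ∷ʳ pair k) ≡ inCUDB n k (τ ∷ʳ (+ k ∷ []))
inCUDD-∷ʳ-pair n k τ rewrite splitLast-∷ʳ τ (pair k) | isNegPair-pair k = refl

npk-++ : ∀ σ ρ → npk (σ ++ ρ) ≡ npk σ ℕ.+ npk ρ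
npk-++ []      ρ = refl
npk-++ (c ∷ σ) ρ rewrite npk-++ σ ρ = sym (ℕ.+-assoc (npkCycle c) (npk σ) (npk ρ))

npkCycle-pair : ∀ m → npkCycle (pair (suc m)) ≡ 1
npkCycle-pair m rewrite Equivalence.to T-≡ (ℕ.≤⇒≤ᵇ (ℕ.≤-refl {suc m})) = refl

npk-∷ʳ-pair : ∀ m τ → npk (τ ∷ʳ pair (suc m)) ≡ suc (npk (τ ∷ʳ (+ suc m ∷ [])))
npk-∷ʳ-pair m τ
  rewrite npk-++ τ (pair (suc m) ∷ []) | npk-++ τ ((+ suc m ∷ []) ∷ []) | npkCycle-pair m =
  ℕ.+-suc (npk τ) 0

weight-npk-suc : ∀ n σ σ′ → npk σ′ ≡ suc (npk σ) → weight n σ′ ≡ weight n σ ℤ.+ ℤ.- + 2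
weight-npk-suc n σ σ′ npk≡ = begin
  weight n σ′                                   ≡⟨ cong (λ k → + suc n - + (2 ℕ.* k)) npk≡ ⟩
  + suc n - + (2 ℕ.* suc (npk σ))               ≡⟨ cong (λ k → + suc n - + k) (ℕ.*-suc 2 (npk σ)) ⟩
  + suc n - + (2 ℕ.+ 2 ℕ.* npk σ)               ≡⟨ cong (λ k → + suc n - k) (ℤ.pos-+ 2 (2 ℕ.* npk σ)) ⟩
  + suc n - (+ 2 ℤ.+ + (2 ℕ.* npk σ))           ≡⟨ shift (+ suc n) (+ (2 ℕ.* npk σ)) ⟩
  weight n σ ℤ.+ ℤ.- + 2                        ∎
  where
  open ≡-Reasoning
  shift : ∀ x y → x - (+ 2 ℤ.+ y) ≡ (x - y) ℤ.+ ℤ.- + 2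
  shift = solve-∀

proposition3p2 : (n : ℕ) → 2 ≤ n → (e : ℤ) →
    FibreB n n e ↔ FibreD n n (e - + 2)
proposition3p2 n@(suc m) _ e = begin
  FibreB n n e
    ↔⟨ Fibre-↔-image (_∷ʳ (+ n ∷ [])) (λ {τ} {τ′} → ∷ʳ-injectiveˡ τ τ′) (inCUDB-max-last n) ⟩
  Fibre (inCUDB n n ∘ (_∷ʳ (+ n ∷ []))) (weight n ∘ (_∷ʳ (+ n ∷ []))) e
    ↔⟨ Fibre-↔-shift (λ τ → sym (inCUDD-∷ʳ-pair n n τ))
                     (λ τ → weight-npk-suc n (τ ∷ʳ (+ n ∷ [])) (τ ∷ʳ pair n) (npk-∷ʳ-pair m τ)) ⟩
  Fibre (inCUDD n n ∘ (_∷ʳ pair n)) (weight n ∘ (_∷ʳ pair n)) (e - + 2)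
    ↔⟨ Fibre-↔-image (_∷ʳ pair n) (λ {τ} {τ′} → ∷ʳ-injectiveˡ τ τ′) (inCUDD-pair-last n n) ⟨
  FibreD n n (e - + 2) ∎
  where open EquationalReasoning
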